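{- If a graph $H$ has a vertex $v$ such that $H\backslash v$ is a forest, then there exists an integer $k$ such that $H$ is isomorphic to a minor of $\mathcal{P}_k$.
   Context: All graphs are finite and simple. A graph $H$ is a minor of $G$ if $H$ can be obtained by contracting edges of a subgraph of $G$. For an integer $h\ge 0$, the binary tree of height $h$, denoted $CT_h$, is the tree with a unique vertex $r$ (the root) of degree two (for $h\ge1$) and all other vertices of degree one or three, such that every vertex of degree one is at distance exactly $h$ from $r$; its leaves are the vertices at distance $h$ from $r$. $\mathcal{P}_k$ is the graph consisting of $CT_k$ together with one additional vertex adjacent to every leaf of $CT_k$. -}

module Defs where

open import Data.Nat using (ℕ; zero; suc; _+_; _*_; _∸_; _^_; _≤?_)
open import Data.Nat.Properties using (_≟_; <⇒≢; n<1+n; m≤m+n; ≤-trans; n≤1+n)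
open import Data.Fin using (Fin; zero; suc; toℕ; punchIn; inject₁; fromℕ)
open import Data.Fin.Properties using (punchInᵢ≢i)
open import Data.Bool using (Bool; true; false; _∨_)
open import Data.Bool.Properties using (∨-comm)
open import Data.Maybe using (Maybe; just)
open import Data.Product using (Σ; ∃; ∃-syntax; _×_; _,_)
open import Data.Empty using (⊥)
open import Function.Definitions using (Injective)
open import Relation.Nullary using (¬_; does)
open import Relation.Nullary.Decidable using (dec-false)
open import Relation.Binary.PropositionalEquality using (_≡_; refl; cong)

record Graph (n : ℕ) : Set where
  field
    adj    : Fin n → Fin n → Bool
    adj-sym : ∀ x y → adj x y ≡ adj y x
    irrefl : ∀ x → adj x x ≡ false
open Graph public

Adj : ∀ {n} → Graph n → Fin n → Fin n → Set
Adj G x y = adj G x y ≡ true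

delete : ∀ {n} → Graph (suc n) → Fin (suc n) → Graph n
delete G v = record
  { adj    = λ x y → adj G (punchIn v x) (punchIn v y)
  ; adj-sym = λ x y → adj-sym G (punchIn v x) (punchIn v y)
  ; irrefl = λ x → irrefl G (punchIn v x)
  }

record Cycle {n} (G : Graph n) : Set where
  field
    len      : ℕ
    vert     : Fin (suc (suc (suc len))) → Fin n
    distinct : Injective _≡_ _≡_ vert
    consec   : ∀ (i : Fin (suc (suc len))) → Adj G (vert (inject₁ i)) (vert (suc i))
    closing  : Adj G (vert (fromℕ (suc (suc len)))) (vert zero)

IsForest : ∀ {n} → Graph n → Set
IsForest G = ¬ Cycle G

-- Minors, via minor models (branch sets).  β x ≡ just u means vertex x
-- of G lies in the branch set of the vertex u of H; β x = nothing means
-- x is deleted.  Branch sets are automatically pairwise disjoint.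

data WalkIn {n} (G : Graph n) (S : Fin n → Set) : Fin n → Fin n → Set where
  here : ∀ {x} → S x → WalkIn G S x x
  step : ∀ {x y z} → S x → Adj G x y → WalkIn G S y z → WalkIn G S x z

record MinorModel {m n} (H : Graph m) (G : Graph n) : Set where
  field
    β         : Fin n → Maybe (Fin m)
    nonempty  : ∀ u → ∃[ x ] β x ≡ just u
    connected : ∀ u x y → β x ≡ just u → β y ≡ just u →
                WalkIn G (λ z → β z ≡ just u) x y
    edges     : ∀ u w → Adj H u w →
                ∃[ x ] ∃[ y ] (β x ≡ just u × β y ≡ just w × Adj G x y)

IsMinorOf : ∀ {m n} → Graph m → Graph n → Set
IsMinorOf H G = MinorModel H G

-- The complete binary tree CT h, in heap numbering: vertices
-- 0,…,2^(h+1)-2, root 0, the children of i are 2i+1 and 2i+2.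
-- Vertex i is at distance h from the root iff i ≥ 2^h - 1.

child : ℕ → ℕ → Bool
child a b = does (b ≟ suc (2 * a)) ∨ does (b ≟ suc (suc (2 * a)))

private
  child-irrefl : ∀ a → child a a ≡ false
  child-irrefl a
    rewrite dec-false (a ≟ suc (2 * a))
                      (<⇒≢ (≤-trans (n<1+n a) (Data.Nat.s≤s (m≤m+n a (a + 0)))))
          | dec-false (a ≟ suc (suc (2 * a)))
                      (<⇒≢ (≤-trans (n<1+n a) (Data.Nat.s≤s (≤-trans (m≤m+n a (a + 0)) (n≤1+n _)))))
    = refl

ctSize : ℕ → ℕ
ctSize h = 2 ^ suc h ∸ 1

CT : (h : ℕ) → Graph (ctSize h)
CT h = record
  { adj    = λ x y → child (toℕ x) (toℕ y) ∨ child (toℕ y) (toℕ x)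
  ; adj-sym = λ x y → ∨-comm (child (toℕ x) (toℕ y)) (child (toℕ y) (toℕ x))
  ; irrefl = λ x → cong (λ b → b ∨ b) (child-irrefl (toℕ x))
  }

isLeaf : (h : ℕ) → Fin (ctSize h) → Bool
isLeaf h x = does (2 ^ h ∸ 1 ≤? toℕ x)

addApex : ∀ {n} → Graph n → (Fin n → Bool) → Graph (suc n)
addApex {n} G L = record { adj = a ; adj-sym = s ; irrefl = i }
  where
  a : Fin (suc n) → Fin (suc n) → Bool
  a zero    zero    = false
  a zero    (suc y) = L y
  a (suc x) zero    = L x
  a (suc x) (suc y) = adj G x y
  s : ∀ x y → a x y ≡ a y x
  s zero zero = refl
  s zero (suc y) = refl
  s (suc x) zero = refl
  s (suc x) (suc y) = adj-sym G x y
  i : ∀ x → a x x ≡ false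
  i zero = refl
  i (suc x) = irrefl G x

𝒫 : (k : ℕ) → Graph (suc (ctSize k))
𝒫 k = addApex (CT k) (isLeaf k)

-- Induction on the number of vertices, keeping a minor model of H in the apex tree of some
-- depth k (the binary tree CT k plus an apex joined to its leaves) in which the apex lies in
-- the branch set of v.  As H − v is a forest, it has a vertex x with at most one neighbour
-- w ≠ v.  A model of H − x extends to H inside the pendant tree, which hangs below every tree
-- node a pendant vertex also joined to the apex: x becomes the pendant of a node in the branch
-- set of w, so it touches that branch set and the apex.  The pendant tree of depth k is a minor
-- of the apex tree of depth 2k + 1, and the apex tree of depth k is 𝒫 k up to the heap
-- numbering of CT k.
module Submission where

open import Defs
open import Data.Bool using (true; _∨_)
open import Data.Bool.Properties as Boolₚ using (∨-zeroʳ)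
open import Data.Empty using (⊥-elim)
open import Data.Fin using (Fin; zero; suc; toℕ; fromℕ<; punchIn; punchOut)
open import Data.Fin.Properties as Finₚ
  using (toℕ-fromℕ<; toℕ-fromℕ; toℕ-inject₁; toℕ-injective; toℕ<n; pigeonhole;
         punchIn-injective; punchInᵢ≢i; punchIn-punchOut; punchOut-injective)
open import Data.List using (_∷_; [])
open import Data.Maybe as Maybe using (Maybe; just; nothing; _>>=_)
open import Data.Maybe.Properties as Maybeₚ using (just-injective; map-just; map-injective)
open import Data.Nat using (ℕ; zero; suc; _+_; _*_; _∸_; _^_; _≟_; _≤_; _<_; _≤?_; s≤s; z≤n)
open import Data.Nat.Properties
  using (+-identityʳ; +-suc; +-comm; +-cancelˡ-≡; +-monoʳ-<; m≤m+n; m+[n∸m]≡n; ≤-trans;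
         <-≤-trans; <-cmp; <⇒≱; <⇒≢; ≤∧≢⇒<; n<1+n; m<1+n⇒m<n∨m≡n; suc-injective;
         ^-monoʳ-≤; ∸-monoˡ-≤; <⇒≤pred; pred[m∸n]≡m∸[1+n])
open import Data.Nat.Tactic.RingSolver using (solve)
open import Data.Product using (∃; ∃-syntax; ∃₂; _×_; _,_; proj₁; proj₂; map₁)
import Data.Product.Properties as Productₚ
open import Data.Sum using (_⊎_; inj₁; inj₂)
open import Function using (id; _∘_; _$_; case_of_)
open import Level using (0ℓ)
open import Relation.Binary using (Rel; Symmetric; DecidableEquality)
open import Relation.Binary.Construct.Closure.ReflexiveTransitive as Star using (Star; ε; _◅_; _◅◅_)
open import Relation.Binary.Construct.Closure.Symmetric as SymClosure using (SymClosure; fwd; bwd)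
open import Relation.Binary.Definitions using (tri<; tri≈; tri>)
open import Relation.Binary.PropositionalEquality
  using (_≡_; _≢_; refl; sym; trans; cong; subst; subst₂; module ≡-Reasoning)
open import Relation.Nullary using (¬_; ¬?; _×-dec_)
open import Relation.Nullary.Decidable as Dec using (Dec; yes; no; dec-true; _⊎-dec_; dec⇒maybe)
open import Relation.Unary using (Pred)

private
  variable
    k n : ℕ

record RelGraph : Set₁ where
  field
    Vertex   : Set
    Edge     : Rel Vertex 0ℓ
    edge-sym : Symmetric Edge
open RelGraph

relGraph : Graph n → RelGraph
relGraph {n} G = record { Vertex = Fin n ; Edge = Adj G ; edge-sym = λ {x} {y} e → trans (adj-sym G y x) e }

Within : {A : Set} → Rel A 0ℓ → Pred A 0ℓ → Rel A 0ℓ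
Within E S a b = S a × E a b × S b

Linked : (G : RelGraph) {A : Set} → (Vertex G → Maybe A) → Rel A 0ℓ
Linked G β u w = ∃₂ λ x y → β x ≡ just u × β y ≡ just w × Edge G x y

Linked-sym : (G : RelGraph) {A : Set} (β : Vertex G → Maybe A) → Symmetric (Linked G β)
Linked-sym G β (x , y , βx , βy , e) = y , x , βy , βx , edge-sym G e

record _≼_ (H G : RelGraph) : Set where
  field
    β         : Vertex G → Maybe (Vertex H)
    nonempty  : ∀ u → ∃[ x ] β x ≡ just u
    connected : ∀ {u x y} → β x ≡ just u → β y ≡ just u →
                Star (Within (Edge G) (λ z → β z ≡ just u)) x y
    edges     : ∀ {u w} → Edge H u w → Linked G β u w
open _≼_

singletons-connected : (G : RelGraph) {A : Set} {β : Vertex G → Maybe A} (ι : A → Vertex G) →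
                       (∀ {u x} → β x ≡ just u → x ≡ ι u) →
                       ∀ {u x y} → β x ≡ just u → β y ≡ just u →
                       Star (Within (Edge G) (λ z → β z ≡ just u)) x y
singletons-connected G ι only p q with only p | only q
... | refl | refl = ε

>>=-just⁻¹ : {A B : Set} (m : Maybe A) {f : A → Maybe B} {b : B} → (m >>= f) ≡ just b →
             ∃[ a ] (m ≡ just a × f a ≡ just b)
>>=-just⁻¹ (just a) eq = a , refl , eq

module _ {H G F : RelGraph} (M : H ≼ G) (N : G ≼ F) where

  private
    β∘ : Vertex F → Maybe (Vertex H)
    β∘ c = β N c >>= β M

    through : ∀ {b u c} → β M b ≡ just u → β N c ≡ just b → β∘ c ≡ just u
    through βb βc = trans (cong (_>>= β M) βc) βb

    inBranch : ∀ {b u c c′} → β M b ≡ just u → β N c ≡ just b → β N c′ ≡ just b →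
               Star (Within (Edge F) (λ z → β∘ z ≡ just u)) c c′
    inBranch βb βc βc′ =
      Star.map (λ (p , e , q) → through βb p , e , through βb q) (connected N βc βc′)

    lift : ∀ {u b b′ c c′} → β M b ≡ just u → Star (Within (Edge G) (λ z → β M z ≡ just u)) b b′ →
           β N c ≡ just b → β N c′ ≡ just b′ → Star (Within (Edge F) (λ z → β∘ z ≡ just u)) c c′
    lift βb ε                    βc βc′ = inBranch βb βc βc′
    lift βb ((_ , e , βb₁) ◅ bs) βc βc′ =
      let (d , d₁ , βd , βd₁ , f) = edges N e
      in  inBranch βb βc βd ◅◅ (through βb βd , f , through βb₁ βd₁) ◅ lift βb₁ bs βd₁ βc′

  ≼-trans : H ≼ F
  ≼-trans = record
    { β         = β∘
    ; nonempty  = λ u → let (b , βb) = nonempty M u ; (c , βc) = nonempty N b in c , through βb βc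
    ; connected = λ {_} {c} {c′} p q →
        let (b , βc , βb) = >>=-just⁻¹ (β N c) p ; (b′ , βc′ , βb′) = >>=-just⁻¹ (β N c′) q
        in lift βb (connected M βb βb′) βc βc′
    ; edges     = λ e →
        let (b , b′ , βb , βb′ , e′) = edges M e ; (c , c′ , βc , βc′ , f) = edges N e′
        in c , c′ , through βb βc , through βb′ βc′ , f
    }

≼⇒IsMinorOf : ∀ {m} {H : Graph m} {G : Graph n} → relGraph H ≼ relGraph G → IsMinorOf H G
≼⇒IsMinorOf {n = n} {G = G} M = record
  { β         = β M
  ; nonempty  = nonempty M
  ; connected = λ _ _ _ p q → walk p (connected M p q)
  ; edges     = λ _ _ → edges M
  }
  where
  walk : ∀ {S : Fin n → Set} {x y} → S x → Star (Within (Adj G) S) x y → WalkIn G S x y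
  walk sx ε                  = here sx
  walk sx ((_ , e , sy) ◅ w) = step sx e (walk sy w)

-- Binary trees, apex trees and pendant trees

-- Addresses are read from the root down: left t is the node t of the left subtree of the root.
data Node : ℕ → Set where
  root       : Node k
  left right : Node k → Node (suc k)

data Child : Rel (Node k) 0ℓ where
  root-left  : Child {suc k} root (left root)
  root-right : Child {suc k} root (right root)
  left       : {a b : Node k} → Child a b → Child (left a) (left b)
  right      : {a b : Node k} → Child a b → Child (right a) (right b)

data Leaf : Node k → Set where
  root  : Leaf {zero} root
  left  : {a : Node k} → Leaf a → Leaf (left a)
  right : {a : Node k} → Leaf a → Leaf (right a)

someLeaf : ∀ k → ∃ (Leaf {k})
someLeaf zero    = root , root
someLeaf (suc k) = let (a , l) = someLeaf k in left a , left l

TreeEdge : Rel (Node k) 0ℓ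
TreeEdge = SymClosure Child

toRoot : (t : Node k) → Star TreeEdge t root
toRoot root      = ε
toRoot (left t)  = Star.gmap left (SymClosure.gmap left left) (toRoot t) ◅◅ bwd root-left ◅ ε
toRoot (right t) = Star.gmap right (SymClosure.gmap right right) (toRoot t) ◅◅ bwd root-right ◅ ε

-- In both graphs below the vertex nothing is the apex.
data ApexArc {k} : Rel (Maybe (Node k)) 0ℓ where
  tree : ∀ {a b} → Child a b → ApexArc (just a) (just b)
  apex : ∀ {a} → Leaf a → ApexArc nothing (just a)

ApexTree : ℕ → RelGraph
ApexTree k = record
  { Vertex   = Maybe (Node k)
  ; Edge     = SymClosure ApexArc
  ; edge-sym = SymClosure.symmetric ApexArc
  }

data Kind : Set where
  node pendant : Kind

_≟ᴷ_ : DecidableEquality Kind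
node    ≟ᴷ node    = yes refl
node    ≟ᴷ pendant = no λ ()
pendant ≟ᴷ node    = no λ ()
pendant ≟ᴷ pendant = yes refl

data PendantArc {k} : Rel (Maybe (Node k × Kind)) 0ℓ where
  tree         : ∀ {a b} → Child a b → PendantArc (just (a , node)) (just (b , node))
  apex         : ∀ {a} → Leaf a → PendantArc nothing (just (a , node))
  pendant      : ∀ {a} → PendantArc (just (a , node)) (just (a , pendant))
  apex-pendant : ∀ {a} → PendantArc nothing (just (a , pendant))

PendantTree : ℕ → RelGraph
PendantTree k = record
  { Vertex   = Maybe (Node k × Kind)
  ; Edge     = SymClosure PendantArc
  ; edge-sym = SymClosure.symmetric PendantArc
  }

module Inclusion where

  include : Maybe (Node k) → Maybe (Node k × Kind)
  include nothing  = nothing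
  include (just t) = just (t , node)

  uninclude : Maybe (Node k × Kind) → Maybe (Maybe (Node k))
  uninclude nothing              = just nothing
  uninclude (just (t , node))    = just (just t)
  uninclude (just (t , pendant)) = nothing

  uninclude-include : (u : Maybe (Node k)) → uninclude (include u) ≡ just u
  uninclude-include nothing  = refl
  uninclude-include (just t) = refl

  uninclude-only : ∀ {u} {x : Maybe (Node k × Kind)} → uninclude x ≡ just u → x ≡ include u
  uninclude-only {x = nothing}         refl = refl
  uninclude-only {x = just (_ , node)} refl = refl

  uninclude-linked : {u w : Maybe (Node k)} → ApexArc u w → Linked (PendantTree k) uninclude u w
  uninclude-linked (tree c) = just (_ , node) , just (_ , node) , refl , refl , fwd (tree c)
  uninclude-linked (apex l) = nothing , just (_ , node) , refl , refl , fwd (apex l)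

ApexTree≼PendantTree : ∀ k → ApexTree k ≼ PendantTree k
ApexTree≼PendantTree k = record
  { β         = uninclude
  ; nonempty  = λ u → include u , uninclude-include u
  ; connected = singletons-connected (PendantTree k) include uninclude-only
  ; edges     = SymClosure.fold (Linked-sym (PendantTree k) uninclude) uninclude-linked
  }
  where open Inclusion

-- Contracting an apex tree onto a pendant tree

double : ℕ → ℕ
double zero    = zero
double (suc k) = suc (suc (double k))

-- In the tree of depth 2k + 1 the root and its left child form the branch set of the root, the
-- right subtree (which contains leaves, hence touches the apex) is the pendant of the root, and
-- the two subtrees below the left child carry the two subtrees of the root.
module Collapse where

  collapse : Node (suc (double k)) → Node k × Kind
  collapse root                     = root , node
  collapse (right _)                = root , pendant
  collapse {zero}  (left root)      = root , node
  collapse {suc k} (left root)      = root , node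
  collapse {suc k} (left (left y))  = map₁ left (collapse y)
  collapse {suc k} (left (right y)) = map₁ right (collapse y)

  representative : Node k × Kind → Node (suc (double k))
  representative (root , node)    = root
  representative (root , pendant) = right root
  representative (left t , κ)     = left (left (representative (t , κ)))
  representative (right t , κ)    = left (right (representative (t , κ)))

  collapse-representative : (u : Node k × Kind) → collapse (representative u) ≡ u
  collapse-representative (root , node)    = refl
  collapse-representative (root , pendant) = refl
  collapse-representative (left t , κ)     = cong (map₁ left) (collapse-representative (t , κ))
  collapse-representative (right t , κ)    = cong (map₁ right) (collapse-representative (t , κ))

  InClass : Node k × Kind → Rel (Node (suc (double k))) 0ℓ
  InClass u = Within TreeEdge (λ z → collapse z ≡ u)

  toRepresentative : (y : Node (suc (double k))) → Star (InClass (collapse y)) y (representative (collapse y))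
  toRepresentative root                     = ε
  toRepresentative (right y)                =
    Star.gmap right (λ e → refl , SymClosure.gmap right right e , refl) (toRoot y)
  toRepresentative {zero}  (left root)      = (refl , bwd root-left , refl) ◅ ε
  toRepresentative {suc k} (left root)      = (refl , bwd root-left , refl) ◅ ε
  toRepresentative {suc k} (left (left y))  =
    Star.gmap (λ z → left (left z))
              (λ (p , e , q) → cong (map₁ left) p , SymClosure.gmap _ (λ c → left (left c)) e ,
                               cong (map₁ left) q)
              (toRepresentative y)
  toRepresentative {suc k} (left (right y)) =
    Star.gmap (λ z → left (right z))
              (λ (p , e , q) → cong (map₁ right) p , SymClosure.gmap _ (λ c → left (right c)) e ,
                               cong (map₁ right) q)
              (toRepresentative y)

  class-connected : ∀ {u} {y y′ : Node (suc (double k))} → collapse y ≡ u → collapse y′ ≡ u →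
                    Star (InClass u) y y′
  class-connected {y = y} {y′} refl q =
    toRepresentative y ◅◅
    subst (λ r → Star (InClass (collapse y)) r y′) (cong representative q)
      (Star.reverse (λ (p , e , p′) → p′ , SymClosure.symmetric Child e , p)
                    (Star.map (λ (p , e , p′) → trans p q , e , trans p′ q) (toRepresentative y′)))

  ChildBetween : Rel (Node k × Kind) 0ℓ
  ChildBetween u w = ∃₂ λ y z → collapse y ≡ u × collapse z ≡ w × Child y z

  LeafIn : Node k × Kind → Set
  LeafIn u = ∃ λ y → collapse y ≡ u × Leaf y

  ChildBetween-left : {u w : Node k × Kind} → ChildBetween u w →
                      ChildBetween (map₁ left u) (map₁ left w)
  ChildBetween-left (y , z , p , q , c) =
    left (left y) , left (left z) , cong (map₁ left) p , cong (map₁ left) q , left (left c)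

  ChildBetween-right : {u w : Node k × Kind} → ChildBetween u w →
                       ChildBetween (map₁ right u) (map₁ right w)
  ChildBetween-right (y , z , p , q , c) =
    left (right y) , left (right z) , cong (map₁ right) p , cong (map₁ right) q , left (right c)

  LeafIn-left : {u : Node k × Kind} → LeafIn u → LeafIn (map₁ left u)
  LeafIn-left (y , p , l) = left (left y) , cong (map₁ left) p , left (left l)

  LeafIn-right : {u : Node k × Kind} → LeafIn u → LeafIn (map₁ right u)
  LeafIn-right (y , p , l) = left (right y) , cong (map₁ right) p , left (right l)

  childBetween-nodes : {a b : Node k} → Child a b → ChildBetween (a , node) (b , node)
  childBetween-nodes root-left  = left root , left (left root) , refl , refl , left root-left
  childBetween-nodes root-right = left root , left (right root) , refl , refl , left root-right
  childBetween-nodes (left c)   = ChildBetween-left (childBetween-nodes c)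
  childBetween-nodes (right c)  = ChildBetween-right (childBetween-nodes c)

  childBetween-pendant : (a : Node k) → ChildBetween (a , node) (a , pendant)
  childBetween-pendant root      = root , right root , refl , refl , root-right
  childBetween-pendant (left a)  = ChildBetween-left (childBetween-pendant a)
  childBetween-pendant (right a) = ChildBetween-right (childBetween-pendant a)

  leafIn-node : {a : Node k} → Leaf a → LeafIn (a , node)
  leafIn-node root      = left root , refl , left root
  leafIn-node (left l)  = LeafIn-left (leafIn-node l)
  leafIn-node (right l) = LeafIn-right (leafIn-node l)

  leafIn-pendant : (a : Node k) → LeafIn (a , pendant)
  leafIn-pendant {k} root = let (y , l) = someLeaf (double k) in right y , refl , right l
  leafIn-pendant (left a)  = LeafIn-left (leafIn-pendant a)
  leafIn-pendant (right a) = LeafIn-right (leafIn-pendant a)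

  contract : Maybe (Node (suc (double k))) → Maybe (Maybe (Node k × Kind))
  contract nothing  = just nothing
  contract (just y) = just (just (collapse y))

  contract-connected : ∀ {u} {x y : Maybe (Node (suc (double k)))} →
                       contract x ≡ just u → contract y ≡ just u →
                       Star (Within (SymClosure ApexArc) (λ z → contract z ≡ just u)) x y
  contract-connected {x = nothing} {nothing} refl refl = ε
  contract-connected {x = just x}  {just y}  refl q    =
    Star.gmap just
      (λ (p , e , p′) → cong (just ∘ just) p , SymClosure.gmap just tree e , cong (just ∘ just) p′)
      (class-connected refl (just-injective (just-injective q)))

  childBetween-linked : {u w : Node k × Kind} → ChildBetween u w →
                        Linked (ApexTree (suc (double k))) contract (just u) (just w)
  childBetween-linked (y , z , p , q , c) =
    just y , just z , cong (just ∘ just) p , cong (just ∘ just) q , fwd (tree c)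

  leafIn-linked : {u : Node k × Kind} → LeafIn u →
                  Linked (ApexTree (suc (double k))) contract nothing (just u)
  leafIn-linked (y , p , l) = nothing , just y , refl , cong (just ∘ just) p , fwd (apex l)

  contract-linked : {u w : Maybe (Node k × Kind)} → PendantArc u w →
                    Linked (ApexTree (suc (double k))) contract u w
  contract-linked (tree c)                              = childBetween-linked (childBetween-nodes c)
  contract-linked {u = just (a , node)} pendant         = childBetween-linked (childBetween-pendant a)
  contract-linked (apex l)                              = leafIn-linked (leafIn-node l)
  contract-linked {w = just (a , pendant)} apex-pendant = leafIn-linked (leafIn-pendant a)

PendantTree≼ApexTree : ∀ k → PendantTree k ≼ ApexTree (suc (double k))
PendantTree≼ApexTree k = record
  { β         = contract
  ; nonempty  = λ { nothing  → nothing , refl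
                  ; (just u) → just (representative u) , cong (just ∘ just) (collapse-representative u) }
  ; connected = contract-connected
  ; edges     = SymClosure.fold (Linked-sym (ApexTree _) contract) contract-linked
  }
  where open Collapse

-- Heap numbering

any? : {P : Node k → Set} → (∀ t → Dec (P t)) → Dec (∃ P)
any? {zero}      P? = Dec.map′ (root ,_) (λ { (root , p) → p }) (P? root)
any? {suc k} {P} P? = Dec.map′ join split (P? root ⊎-dec any? (P? ∘ left) ⊎-dec any? (P? ∘ right))
  where
  join : P root ⊎ ∃ (P ∘ left) ⊎ ∃ (P ∘ right) → ∃ P
  join (inj₁ p)              = root , p
  join (inj₂ (inj₁ (t , p))) = left t , p
  join (inj₂ (inj₂ (t , p))) = right t , p
  split : ∃ P → P root ⊎ ∃ (P ∘ left) ⊎ ∃ (P ∘ right)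
  split (root , p)    = inj₁ p
  split (left t , p)  = inj₂ (inj₁ (t , p))
  split (right t , p) = inj₂ (inj₂ (t , p))

-- heap is the numbering of CT k: 1 + heap t is the binary numeral 1 b₁ ⋯ b_d of the path t
-- (left = 0, right = 1), that is 2 ^ depth t + offset t.
module Heap where

  depth : Node k → ℕ
  depth root      = 0
  depth (left t)  = suc (depth t)
  depth (right t) = suc (depth t)

  offset : Node k → ℕ
  offset root      = 0
  offset (left t)  = offset t
  offset (right t) = 2 ^ depth t + offset t

  heap : Node k → ℕ
  heap root      = 0
  heap (left t)  = 2 ^ depth t + heap t
  heap (right t) = 2 ^ suc (depth t) + heap t

  depth-child : {a b : Node k} → Child a b → depth b ≡ suc (depth a)
  depth-child root-left  = refl
  depth-child root-right = refl
  depth-child (left c)   = cong suc (depth-child c)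
  depth-child (right c)  = cong suc (depth-child c)

  HeapChild : Rel ℕ 0ℓ
  HeapChild i j = j ≡ suc (2 * i) ⊎ j ≡ suc (suc (2 * i))

  HeapChild-shift : ∀ P {i j} → HeapChild i j → HeapChild (P + i) (2 * P + j)
  HeapChild-shift P {i} (inj₁ refl) = inj₁ (solve (P ∷ i ∷ []))
  HeapChild-shift P {i} (inj₂ refl) = inj₂ (solve (P ∷ i ∷ []))

  heap-child : {a b : Node k} → Child a b → HeapChild (heap a) (heap b)
  heap-child root-left  = inj₁ refl
  heap-child root-right = inj₂ refl
  heap-child {a = left a}  (left c)  rewrite depth-child c = HeapChild-shift (2 ^ depth a) (heap-child c)
  heap-child {a = right a} (right c) rewrite depth-child c = HeapChild-shift (2 ^ suc (depth a)) (heap-child c)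

  child-true : ∀ {i j} → HeapChild i j → child i j ≡ true
  child-true {i} {j} (inj₁ eq) rewrite dec-true (j ≟ suc (2 * i)) eq       = refl
  child-true {i} {j} (inj₂ eq) rewrite dec-true (j ≟ suc (suc (2 * i))) eq = ∨-zeroʳ _

  2^d+o<2^[1+d] : ∀ d {o} → o < 2 ^ d → 2 ^ d + o < 2 ^ suc d
  2^d+o<2^[1+d] d {o} o< =
    subst (2 ^ d + o <_) (cong (2 ^ d +_) (sym (+-identityʳ (2 ^ d)))) (+-monoʳ-< (2 ^ d) o<)

  offset< : (t : Node k) → offset t < 2 ^ depth t
  offset< root      = s≤s z≤n
  offset< (left t)  = <-≤-trans (offset< t) (m≤m+n (2 ^ depth t) _)
  offset< (right t) = 2^d+o<2^[1+d] (depth t) (offset< t)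

  suc-heap : (t : Node k) → suc (heap t) ≡ 2 ^ depth t + offset t
  suc-heap root      = refl
  suc-heap (left t)  = begin
    suc (2 ^ d + heap t)     ≡⟨ sym (+-suc (2 ^ d) (heap t)) ⟩
    2 ^ d + suc (heap t)     ≡⟨ cong (2 ^ d +_) (suc-heap t) ⟩
    2 ^ d + (2 ^ d + offset t) ≡⟨ twice (2 ^ d) (offset t) ⟩
    2 ^ suc d + offset t     ∎
    where
    open ≡-Reasoning
    d = depth t
    twice : ∀ m o → m + (m + o) ≡ 2 * m + o
    twice m o = solve (m ∷ o ∷ [])
  suc-heap (right t) =
    trans (sym (+-suc (2 ^ suc (depth t)) (heap t))) (cong (2 ^ suc (depth t) +_) (suc-heap t))

  leading-digit-unique : ∀ d d′ {o o′} → o < 2 ^ d → o′ < 2 ^ d′ →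
                         2 ^ d + o ≡ 2 ^ d′ + o′ → d ≡ d′ × o ≡ o′
  leading-digit-unique d d′ o< o′< eq with <-cmp d d′
  ... | tri< d<d′ _ _ = ⊥-elim $ <⇒≱ (2^d+o<2^[1+d] d o<) $
    ≤-trans (^-monoʳ-≤ 2 d<d′) (subst (2 ^ d′ ≤_) (sym eq) (m≤m+n _ _))
  ... | tri≈ _ refl _ = refl , +-cancelˡ-≡ (2 ^ d) _ _ eq
  ... | tri> _ _ d′<d = ⊥-elim $ <⇒≱ (2^d+o<2^[1+d] d′ o′<) $
    ≤-trans (^-monoʳ-≤ 2 d′<d) (subst (2 ^ d ≤_) eq (m≤m+n _ _))

  depth-offset-injective : {s t : Node k} → depth s ≡ depth t → offset s ≡ offset t → s ≡ t
  depth-offset-injective {s = root}    {root}    _  _  = refl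
  depth-offset-injective {s = left s}  {left t}  ds os =
    cong left (depth-offset-injective (suc-injective ds) os)
  depth-offset-injective {s = right s} {right t} ds os =
    cong right (depth-offset-injective (suc-injective ds)
                  (proj₂ (leading-digit-unique (depth s) (depth t) (offset< s) (offset< t) os)))
  depth-offset-injective {s = left s}  {right t} ds os = ⊥-elim $
    <⇒≱ (subst (λ d → offset s < 2 ^ d) (suc-injective ds) (offset< s))
        (subst (2 ^ depth t ≤_) (sym os) (m≤m+n _ _))
  depth-offset-injective {s = right s} {left t}  ds os = ⊥-elim $
    <⇒≱ (subst (λ d → offset t < 2 ^ d) (sym (suc-injective ds)) (offset< t))
        (subst (2 ^ depth s ≤_) os (m≤m+n _ _))

  heap-injective : {s t : Node k} → heap s ≡ heap t → s ≡ t
  heap-injective {s = s} {t} eq =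
    let (ds , os) = leading-digit-unique (depth s) (depth t) (offset< s) (offset< t)
                      (trans (sym (suc-heap s)) (trans (cong suc eq) (suc-heap t)))
    in depth-offset-injective ds os

  _≟ᴺ_ : DecidableEquality (Node k)
  s ≟ᴺ t = Dec.map′ heap-injective (cong heap) (heap s ≟ heap t)

  depth≤ : (t : Node k) → depth t ≤ k
  depth≤ root      = z≤n
  depth≤ (left t)  = s≤s (depth≤ t)
  depth≤ (right t) = s≤s (depth≤ t)

  heap<ctSize : (t : Node k) → heap t < ctSize k
  heap<ctSize {k} t = subst (heap t <_) (pred[m∸n]≡m∸[1+n] (2 ^ suc k) 0) $ <⇒≤pred $
    subst (_< 2 ^ suc k) (sym (suc-heap t))
          (<-≤-trans (2^d+o<2^[1+d] (depth t) (offset< t)) (^-monoʳ-≤ 2 (s≤s (depth≤ t))))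

  leaf-depth : {t : Node k} → Leaf t → depth t ≡ k
  leaf-depth root      = refl
  leaf-depth (left l)  = cong suc (leaf-depth l)
  leaf-depth (right l) = cong suc (leaf-depth l)

  leaf-heap : {t : Node k} → Leaf t → 2 ^ k ∸ 1 ≤ heap t
  leaf-heap {t = t} l =
    ∸-monoˡ-≤ 1 $ subst₂ (λ d h → 2 ^ d ≤ h) (leaf-depth l) (sym (suc-heap t)) (m≤m+n _ _)

  heap⁻¹? : ∀ h → Dec (∃ λ (t : Node k) → heap t ≡ h)
  heap⁻¹? h = any? (λ t → heap t ≟ h)

  decode : ℕ → Maybe (Node k)
  decode h = Maybe.map proj₁ (dec⇒maybe (heap⁻¹? h))

  decode-heap : (t : Node k) → decode (heap t) ≡ just t
  decode-heap t = found (heap⁻¹? (heap t))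
    where
    found : (d : Dec (∃ λ s → heap s ≡ heap t)) → Maybe.map proj₁ (dec⇒maybe d) ≡ just t
    found (yes (s , eq)) = cong just (heap-injective eq)
    found (no none)      = ⊥-elim (none (t , refl))

  decode-only : ∀ h {t : Node k} → decode h ≡ just t → heap t ≡ h
  decode-only h = found (heap⁻¹? h)
    where
    found : ∀ {t} (d : Dec (∃ λ s → heap s ≡ h)) →
            Maybe.map proj₁ (dec⇒maybe d) ≡ just t → heap t ≡ h
    found (yes (s , eq)) refl = eq

module Labelling (k : ℕ) where
  open Heap

  vertex : Node k → Fin (ctSize k)
  vertex t = fromℕ< (heap<ctSize t)

  toℕ-vertex : ∀ t → toℕ (vertex t) ≡ heap t
  toℕ-vertex t = toℕ-fromℕ< (heap<ctSize t)

  label : Maybe (Node k) → Fin (suc (ctSize k))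
  label nothing  = zero
  label (just t) = suc (vertex t)

  unlabel : Fin (suc (ctSize k)) → Maybe (Maybe (Node k))
  unlabel zero    = just nothing
  unlabel (suc i) = Maybe.map just (decode (toℕ i))

  unlabel-label : (u : Maybe (Node k)) → unlabel (label u) ≡ just u
  unlabel-label nothing  = refl
  unlabel-label (just t) = cong (Maybe.map just) (trans (cong decode (toℕ-vertex t)) (decode-heap t))

  unlabel-only : ∀ {u} (x : Fin (suc (ctSize k))) → unlabel x ≡ just u → x ≡ label u
  unlabel-only zero    refl = refl
  unlabel-only (suc i)      = from (decode (toℕ i)) refl
    where
    from : ∀ {u} m → decode (toℕ i) ≡ m → Maybe.map just m ≡ just u → suc i ≡ label u
    from (just t) dec refl =
      cong suc (toℕ-injective (trans (sym (decode-only (toℕ i) dec)) (sym (toℕ-vertex t))))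

  CT-adj : ∀ {i j : Fin (ctSize k)} → child (toℕ i) (toℕ j) ≡ true → Adj (CT k) i j
  CT-adj {i} {j} p = cong (_∨ child (toℕ j) (toℕ i)) p

  unlabel-linked : {u w : Maybe (Node k)} → ApexArc u w → Linked (relGraph (𝒫 k)) unlabel u w
  unlabel-linked {u} {w} (tree {a} {b} c) = label u , label w , unlabel-label u , unlabel-label w ,
    CT-adj {vertex a} {vertex b} (subst₂ (λ i j → child i j ≡ true) (sym (toℕ-vertex a)) (sym (toℕ-vertex b))
                                         (child-true {heap a} (heap-child c)))
  unlabel-linked {u} {w} (apex {a} l) = label u , label w , unlabel-label u , unlabel-label w ,
    dec-true (2 ^ k ∸ 1 ≤? _) (subst (2 ^ k ∸ 1 ≤_) (sym (toℕ-vertex a)) (leaf-heap l))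

ApexTree≼𝒫 : ∀ k → ApexTree k ≼ relGraph (𝒫 k)
ApexTree≼𝒫 k = record
  { β         = unlabel
  ; nonempty  = λ u → label u , unlabel-label u
  ; connected = singletons-connected (relGraph (𝒫 k)) label (unlabel-only _)
  ; edges     = SymClosure.fold (Linked-sym (relGraph (𝒫 k)) unlabel) unlabel-linked
  }
  where open Labelling k

-- Cycles and forests

Adj⇒≢ : (G : Graph n) {x y : Fin n} → Adj G x y → x ≢ y
Adj⇒≢ G {x} e refl with () ← trans (sym e) (irrefl G x)

InjectiveBelow : {A : Set} → (ℕ → A) → ℕ → Set
InjectiveBelow f j = ∀ {a b} → a < j → b < j → f a ≡ f b → a ≡ b

module _ (f : ℕ → Fin n) where

  private
    injectiveBelow-suc : ∀ {j} → InjectiveBelow f j → (∀ (i : Fin j) → f (toℕ i) ≢ f j) →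
                         InjectiveBelow f (suc j)
    injectiveBelow-suc injective fresh a<1+j b<1+j fa≡fb
      with m<1+n⇒m<n∨m≡n a<1+j | m<1+n⇒m<n∨m≡n b<1+j
    ... | inj₁ a<j  | inj₁ b<j  = injective a<j b<j fa≡fb
    ... | inj₁ a<j  | inj₂ refl = ⊥-elim (fresh (fromℕ< a<j) (trans (cong f (toℕ-fromℕ< a<j)) fa≡fb))
    ... | inj₂ refl | inj₁ b<j  = ⊥-elim (fresh (fromℕ< b<j) (trans (cong f (toℕ-fromℕ< b<j)) (sym fa≡fb)))
    ... | inj₂ refl | inj₂ refl = refl

    ¬injectiveBelow-suc : ¬ InjectiveBelow f (suc n)
    ¬injectiveBelow-suc injective =
      let (i , j , i<j , fi≡fj) = pigeonhole (n<1+n n) (f ∘ toℕ)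
      in <⇒≢ i<j (injective (toℕ<n i) (toℕ<n j) fi≡fj)

    scan : ∀ r j → r + j ≡ suc n → InjectiveBelow f j →
           ∃₂ λ i j → i < j × f i ≡ f j × InjectiveBelow f j
    scan zero    j refl  injective = ⊥-elim (¬injectiveBelow-suc injective)
    scan (suc r) j r+j≡n injective with Finₚ.any? (λ (i : Fin j) → f (toℕ i) Finₚ.≟ f j)
    ... | yes (i , fi≡fj) = toℕ i , j , toℕ<n i , fi≡fj , injective
    ... | no  fresh       =
      scan r (suc j) (trans (+-suc r j) r+j≡n) (injectiveBelow-suc injective (λ i → fresh ∘ (i ,_)))

  firstRepetition : ∃₂ λ i j → i < j × f i ≡ f j × InjectiveBelow f j
  firstRepetition = scan (suc n) 0 (+-identityʳ (suc n)) (λ ())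

module _ (G : Graph n) where

  record NonBacktrackingWalk : Set where
    field
      walk             : ℕ → Fin n
      adjacent         : ∀ i → Adj G (walk i) (walk (suc i))
      non-backtracking : ∀ i → walk (suc (suc i)) ≢ walk i

  closedWalk⇒cycle : (g : ℕ → Fin n) (ℓ : ℕ) → (∀ t → Adj G (g t) (g (suc t))) →
                     g (3 + ℓ) ≡ g 0 → InjectiveBelow g (3 + ℓ) → Cycle G
  closedWalk⇒cycle g ℓ adjacent closed injective = record
    { len      = ℓ
    ; vert     = g ∘ toℕ
    ; distinct = λ {i} {j} eq → toℕ-injective (injective (toℕ<n i) (toℕ<n j) eq)
    ; consec   = λ i → subst (λ t → Adj G (g t) (g (suc (toℕ i)))) (sym (toℕ-inject₁ i))
                             (adjacent (toℕ i))
    ; closing  = subst₂ (Adj G) (cong g (sym (toℕ-fromℕ (2 + ℓ)))) closed (adjacent (2 + ℓ))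
    }

  nonBacktrackingWalk⇒cycle : NonBacktrackingWalk → Cycle G
  nonBacktrackingWalk⇒cycle w with firstRepetition (NonBacktrackingWalk.walk w)
  ... | i , j , i<j , wi≡wj , injective-j =
    closedWalk⇒cycle (walk ∘ (i +_)) ℓ adjacent′ closed injective
    where
    open NonBacktrackingWalk w
    3+i≤j : 3 + i ≤ j
    3+i≤j = ≤∧≢⇒< (≤∧≢⇒< i<j λ eq → Adj⇒≢ G (adjacent i) (trans wi≡wj (cong walk (sym eq))))
                  λ eq → non-backtracking i (trans (cong walk eq) (sym wi≡wj))
    ℓ = j ∸ (3 + i)
    i+3+ℓ≡j : i + (3 + ℓ) ≡ j
    i+3+ℓ≡j = trans (trans (+-comm i (3 + ℓ)) (cong (3 +_) (+-comm ℓ i))) (m+[n∸m]≡n 3+i≤j)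
    adjacent′ : ∀ t → Adj G (walk (i + t)) (walk (i + suc t))
    adjacent′ t = subst (Adj G (walk (i + t)) ∘ walk) (sym (+-suc i t)) (adjacent (i + t))
    closed : walk (i + (3 + ℓ)) ≡ walk (i + 0)
    closed = trans (cong walk i+3+ℓ≡j) (trans (sym wi≡wj) (cong walk (sym (+-identityʳ i))))
    below : ∀ {a} → a < 3 + ℓ → i + a < j
    below a< = subst (i + _ <_) i+3+ℓ≡j (+-monoʳ-< i a<)
    injective : InjectiveBelow (walk ∘ (i +_)) (3 + ℓ)
    injective a< b< eq = +-cancelˡ-≡ i _ _ (injective-j (below a<) (below b<) eq)

  TwoNeighbours : Fin n → Set
  TwoNeighbours y = ∃₂ λ a b → Adj G y a × Adj G y b × a ≢ b

  Degree≤1 : Fin n → Set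
  Degree≤1 y = ∀ {a b} → Adj G y a → Adj G y b → a ≡ b

  twoNeighbours? : ∀ y → Dec (TwoNeighbours y)
  twoNeighbours? y = Finₚ.any? λ a → Finₚ.any? λ b →
    (adj G y a Boolₚ.≟ true) ×-dec (adj G y b Boolₚ.≟ true) ×-dec ¬? (a Finₚ.≟ b)

  ¬twoNeighbours⇒degree≤1 : ∀ {y} → ¬ TwoNeighbours y → Degree≤1 y
  ¬twoNeighbours⇒degree≤1 ¬two {a} {b} ya yb =
    Dec.decidable-stable (a Finₚ.≟ b) (λ a≢b → ¬two (a , b , ya , yb , a≢b))

module _ (G : Graph (suc n)) (two : ∀ y → TwoNeighbours G y) where

  private
    otherNeighbour : (x y : Fin (suc n)) → ∃[ z ] (Adj G y z × z ≢ x)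
    otherNeighbour x y with two y
    ... | a , b , ya , yb , a≢b with a Finₚ.≟ x
    ...   | yes refl = b , yb , a≢b ∘ sym
    ...   | no  a≢x  = a , ya , a≢x

    steps : ℕ → Fin (suc n) × Fin (suc n)
    steps zero    = zero , proj₁ (two zero)
    steps (suc i) = let (x , y) = steps i in y , proj₁ (otherNeighbour x y)

    steps-adjacent : ∀ i → Adj G (proj₁ (steps i)) (proj₂ (steps i))
    steps-adjacent zero    = proj₁ (proj₂ (proj₂ (two zero)))
    steps-adjacent (suc i) = proj₁ (proj₂ (otherNeighbour _ _))

  twoNeighbours⇒walk : NonBacktrackingWalk G
  twoNeighbours⇒walk = record
    { walk             = proj₁ ∘ steps
    ; adjacent         = steps-adjacent
    ; non-backtracking = λ i → proj₂ (proj₂ (otherNeighbour _ _))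
    }

forest⇒∃degree≤1 : (G : Graph (suc n)) → IsForest G → ∃ (Degree≤1 G)
forest⇒∃degree≤1 G forest with Finₚ.all? (twoNeighbours? G)
... | yes two  = ⊥-elim (forest (nonBacktrackingWalk⇒cycle G (twoNeighbours⇒walk G two)))
... | no  ¬two =
  let (y , ¬two-y) = Finₚ.¬∀⟶∃¬ _ _ (twoNeighbours? G) ¬two in y , ¬twoNeighbours⇒degree≤1 G ¬two-y

module _ {n′} {G : Graph n} {G′ : Graph n′} (C : Cycle G) where
  open Cycle C

  mapCycle : (g : Fin (3 + len) → Fin n′) → (∀ {i j} → g i ≡ g j → i ≡ j) →
             (∀ {i j} → Adj G (vert i) (vert j) → Adj G′ (g i) (g j)) → Cycle G′
  mapCycle g injective adjacent = record
    { len = len ; vert = g ; distinct = injective ; consec = adjacent ∘ consec ; closing = adjacent closing }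

cycle-punchIn : (H : Graph (suc n)) (x : Fin (suc n)) → Cycle (delete H x) → Cycle H
cycle-punchIn H x C = mapCycle C (punchIn x ∘ Cycle.vert C) (Cycle.distinct C ∘ punchIn-injective x _ _) id

Avoids : {G : Graph n} → Cycle G → Fin n → Set
Avoids C v = ∀ i → Cycle.vert C i ≢ v

-- Unlike IsForest (delete H v), this survives the deletion of other vertices without relabelling v.
NoCycleAvoiding : Graph n → Fin n → Set
NoCycleAvoiding H v = (C : Cycle H) → ¬ Avoids C v

forest⇒noCycleAvoiding : {H : Graph (suc n)} {v : Fin (suc n)} →
                         IsForest (delete H v) → NoCycleAvoiding H v
forest⇒noCycleAvoiding {H = H} {v} forest C avoids =
  forest (mapCycle C (λ i → punchOut (v≢ i)) (Cycle.distinct C ∘ punchOut-injective (v≢ _) (v≢ _))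
                     (subst₂ (Adj H) (sym (punchIn-punchOut (v≢ _))) (sym (punchIn-punchOut (v≢ _)))))
  where
  v≢ : ∀ i → v ≢ Cycle.vert C i
  v≢ i = avoids i ∘ sym

noCycleAvoiding⇒forest : {H : Graph (suc n)} {v : Fin (suc n)} →
                         NoCycleAvoiding H v → IsForest (delete H v)
noCycleAvoiding⇒forest {H = H} {v} noCycle C = noCycle (cycle-punchIn H v C) (λ _ → punchInᵢ≢i v _)

noCycleAvoiding-delete : {H : Graph (suc n)} {v x : Fin (suc n)} (x≢v : x ≢ v) →
                         NoCycleAvoiding H v → NoCycleAvoiding (delete H x) (punchOut x≢v)
noCycleAvoiding-delete {H = H} {v} {x} x≢v noCycle C avoids =
  noCycle (cycle-punchIn H x C)
          (λ i eq → avoids i (punchIn-injective x _ _ (trans eq (sym (punchIn-punchOut x≢v)))))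

-- Adding a vertex to a minor model, and the induction

data PunchView (x : Fin (suc n)) : Fin (suc n) → Set where
  at      : PunchView x x
  punched : ∀ u → PunchView x (punchIn x u)

punchView : (x u : Fin (suc n)) → PunchView x u
punchView x u with u Finₚ.≟ x
... | yes refl = at
... | no  u≢x  = subst (PunchView x) (punchIn-punchOut (u≢x ∘ sym)) (punched _)

module ExtendModel
  (H : Graph (suc n)) (x : Fin (suc n)) {G : RelGraph} (M : relGraph (delete H x) ≼ G)
  (z : Vertex G) (z? : ∀ y → Dec (y ≡ z)) (z-unused : β M z ≡ nothing)
  (z-adjacent : ∀ {a} → Adj H x a → ∃[ y ] (Edge G z y × Maybe.map (punchIn x) (β M y) ≡ just a))
  where

  β⁺ : Vertex G → Maybe (Fin (suc n))
  β⁺ y with z? y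
  ... | yes _ = just x
  ... | no  _ = Maybe.map (punchIn x) (β M y)

  β⁺-z : β⁺ z ≡ just x
  β⁺-z with z? z
  ... | yes _   = refl
  ... | no  z≢z = ⊥-elim (z≢z refl)

  β⁺-lift : ∀ {y a} → Maybe.map (punchIn x) (β M y) ≡ just a → β⁺ y ≡ just a
  β⁺-lift {y} p with z? y
  ... | yes refl = case trans (sym (cong (Maybe.map (punchIn x)) z-unused)) p of λ ()
  ... | no  _    = p

  β⁺-just : ∀ {y u} → β M y ≡ just u → β⁺ y ≡ just (punchIn x u)
  β⁺-just p = β⁺-lift (map-just p)

  β⁺-x : ∀ {y} → β⁺ y ≡ just x → y ≡ z
  β⁺-x {y} p with z? y
  ... | yes y≡z = y≡z
  ... | no  _   = ⊥-elim (map-punchIn≢x (β M y) p)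
    where
    map-punchIn≢x : ∀ m → Maybe.map (punchIn x) m ≢ just x
    map-punchIn≢x (just u) p = punchInᵢ≢i x u (just-injective p)

  β⁺-punchIn : ∀ {y u} → β⁺ y ≡ just (punchIn x u) → β M y ≡ just u
  β⁺-punchIn {y} {u} p with z? y
  ... | yes _ = ⊥-elim (punchInᵢ≢i x u (sym (just-injective p)))
  ... | no  _ = map-injective (λ {a} {b} → punchIn-injective x a b) p

  linked-z : ∀ {a} → Adj H x a → Linked G β⁺ x a
  linked-z e = let (y , zy , p) = z-adjacent e in z , y , β⁺-z , β⁺-lift p , zy

  nonempty⁺ : ∀ u → ∃[ y ] β⁺ y ≡ just u
  nonempty⁺ u with punchView x u
  ... | at         = z , β⁺-z
  ... | punched u′ = let (y , p) = nonempty M u′ in y , β⁺-just p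

  connected⁺ : ∀ {u y y′} → β⁺ y ≡ just u → β⁺ y′ ≡ just u →
               Star (Within (Edge G) (λ z → β⁺ z ≡ just u)) y y′
  connected⁺ {u} p q with punchView x u
  ... | at with refl ← β⁺-x p | refl ← β⁺-x q = ε
  ... | punched u′ =
    Star.map (λ (r , e , s) → β⁺-just r , e , β⁺-just s) (connected M (β⁺-punchIn p) (β⁺-punchIn q))

  edges⁺ : ∀ {u w} → Adj H u w → Linked G β⁺ u w
  edges⁺ {u} {w} e with punchView x u | punchView x w
  ... | at         | at         = ⊥-elim (Adj⇒≢ H e refl)
  ... | at         | punched _  = linked-z e
  ... | punched _  | at         = Linked-sym G β⁺ (linked-z (trans (adj-sym H x u) e))
  ... | punched u′ | punched w′ =
    let (y , y′ , p , q , f) = edges M e in y , y′ , β⁺-just p , β⁺-just q , f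

  extended : relGraph H ≼ G
  extended = record { β = β⁺ ; nonempty = nonempty⁺ ; connected = connected⁺ ; edges = edges⁺ }

record ApexTreeModel (H : Graph n) (v : Fin n) : Set where
  field
    height : ℕ
    model  : relGraph H ≼ ApexTree height
    apex↦v : β model nothing ≡ just v

single-vertex : (H : Graph 1) → ApexTreeModel H zero
single-vertex H = record { height = 0 ; model = M ; apex↦v = refl }
  where
  β₀ : Maybe (Node 0) → Maybe (Fin 1)
  β₀ nothing  = just zero
  β₀ (just _) = nothing
  only : ∀ {u} y → β₀ y ≡ just u → y ≡ nothing
  only nothing refl = refl
  M : relGraph H ≼ ApexTree 0
  M = record
    { β         = β₀
    ; nonempty  = λ { zero → nothing , refl }
    ; connected = singletons-connected (ApexTree 0) (λ _ → nothing) (only _)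
    ; edges     = λ { {zero} {zero} e → ⊥-elim (Adj⇒≢ H e refl) }
    }

Degree≤1Besides : Graph n → Fin n → Fin n → Set
Degree≤1Besides H v x = ∀ {a b} → a ≢ v → b ≢ v → Adj H x a → Adj H x b → a ≡ b

degree≤1-punchIn : (H : Graph (suc n)) (v : Fin (suc n)) {y : Fin n} →
                   Degree≤1 (delete H v) y → Degree≤1Besides H v (punchIn v y)
degree≤1-punchIn H v degree≤1 {a} {b} a≢v b≢v ea eb with punchView v a | punchView v b
... | at         | _          = ⊥-elim (a≢v refl)
... | punched _  | at         = ⊥-elim (b≢v refl)
... | punched a′ | punched b′ = cong (punchIn v) (degree≤1 ea eb)

module AttachLeaf (H : Graph (suc (suc n))) {v x} (x≢v : x ≢ v) (leaf : Degree≤1Besides H v x)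
                  (T : ApexTreeModel (delete H x) (punchOut x≢v)) where
  open ApexTreeModel T

  Attachment : Node height → Set
  Attachment c = ∀ {a} → a ≢ v → Adj H x a → Maybe.map (punchIn x) (β model (just c)) ≡ just a

  attachment : ∃ Attachment
  attachment with Finₚ.any? (λ a → ¬? (a Finₚ.≟ v) ×-dec (adj H x a Boolₚ.≟ true))
  ... | no  none             = root , λ a≢v e → ⊥-elim (none (_ , a≢v , e))
  ... | yes (a₀ , a₀≢v , e₀) = attach (nonempty model (punchOut x≢a₀))
    where
    x≢a₀ = Adj⇒≢ H e₀
    attach : ∃[ y ] β model y ≡ just (punchOut x≢a₀) → ∃ Attachment
    attach (nothing , p) =
      ⊥-elim (a₀≢v (sym (punchOut-injective x≢v x≢a₀ (just-injective (trans (sym apex↦v) p)))))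
    attach (just c , p)  =
      c , λ a≢v e → trans (map-just p) (cong just (trans (punchIn-punchOut x≢a₀) (leaf a₀≢v a≢v e₀ e)))

  c = proj₁ attachment

  M : relGraph (delete H x) ≼ PendantTree height
  M = ≼-trans model (ApexTree≼PendantTree height)

  apex↦v⁺ : Maybe.map (punchIn x) (β M nothing) ≡ just v
  apex↦v⁺ = trans (map-just apex↦v) (cong just (punchIn-punchOut x≢v))

  pendant-adjacent : ∀ {a} → Adj H x a → ∃[ y ] (SymClosure PendantArc (just (c , pendant)) y ×
                                                 Maybe.map (punchIn x) (β M y) ≡ just a)
  pendant-adjacent {a} e with a Finₚ.≟ v
  ... | yes refl = nothing , bwd apex-pendant , apex↦v⁺
  ... | no  a≢v  = just (c , node) , bwd pendant , proj₂ attachment a≢v e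

  pendant? : ∀ y → Dec (y ≡ just (c , pendant))
  pendant? y = Maybeₚ.≡-dec (Productₚ.≡-dec Heap._≟ᴺ_ _≟ᴷ_) y (just (c , pendant))

  open ExtendModel H x M (just (c , pendant)) pendant? refl pendant-adjacent

  result : ApexTreeModel H v
  result = record
    { height = suc (double height)
    ; model  = ≼-trans extended (PendantTree≼ApexTree height)
    ; apex↦v = β⁺-lift {nothing} apex↦v⁺
    }

apexTreeModel : (H : Graph (suc n)) (v : Fin (suc n)) → NoCycleAvoiding H v → ApexTreeModel H v
apexTreeModel {zero}  H zero _       = single-vertex H
apexTreeModel {suc n} H v    noCycle =
  let (y , degree≤1) = forest⇒∃degree≤1 (delete H v) (noCycleAvoiding⇒forest noCycle)
      x≢v            = punchInᵢ≢i v y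
  in AttachLeaf.result H x≢v (degree≤1-punchIn H v degree≤1)
       (apexTreeModel (delete H (punchIn v y)) (punchOut x≢v) (noCycleAvoiding-delete x≢v noCycle))

lemma2p2 : ∀ {n} (H : Graph (suc n)) (v : Fin (suc n)) →
    IsForest (delete H v) → ∃[ k ] IsMinorOf H (𝒫 k)
lemma2p2 H v forest =
  let open ApexTreeModel (apexTreeModel H v (forest⇒noCycleAvoiding forest))
  in height , ≼⇒IsMinorOf (≼-trans model (ApexTree≼𝒫 height))
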